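{- Let $R$ be a noetherian integral domain with field of fractions $K\neq R$, $A$ a finite-dimensional $K$-algebra and $\Lambda$ an $R$-order in $A$. Two $\Lambda$-lattices $X$ and $Y$ are isomorphic if and only if (a) the $\mathrm{End}_\Lambda(Y)$-lattice $\mathrm{Hom}_\Lambda(X,Y)$ is free of rank $1$, and (b) every (equivalently, any) free generator of $\mathrm{Hom}_\Lambda(X,Y)$ over $\mathrm{End}_\Lambda(Y)$ is an isomorphism.
   Context: An $R$-order in $A$ is a subring (same unity) that is a finitely generated $R$-submodule containing a $K$-basis of $A$. A $\Lambda$-lattice is a left $\Lambda$-module finitely generated and torsion-free over $R$. $\mathrm{End}_\Lambda(Y)$ is an $R$-order in $\mathrm{End}_A(KY)$ and $\mathrm{Hom}_\Lambda(X,Y)$ is a left $\mathrm{End}_\Lambda(Y)$-lattice via post-composition. -}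

module Defs where

open import Level using (0ℓ)
open import Data.Nat using (ℕ; zero; suc)
open import Data.Fin using (Fin; zero; suc)
open import Data.Product using (Σ; ∃; _×_; _,_)
open import Data.Sum using (_⊎_)
open import Relation.Nullary using (¬_)
open import Relation.Unary using (Pred)
open import Function using (_⇔_)
open import Algebra.Bundles using (Ring; CommutativeRing; RawRing)
open import Algebra.Module.Bundles using (LeftModule)
open import Algebra.Morphism.Structures using (module RingMorphisms)
open import Algebra.Module.Morphism.Structures using (module LeftModuleMorphisms)

∑ : {C : Set} → (C → C → C) → C → (n : ℕ) → (Fin n → C) → C
∑ _+_ z zero    f = z
∑ _+_ z (suc n) f = f zero + ∑ _+_ z n (λ i → f (suc i))

IsRingHom : (R S : Ring 0ℓ 0ℓ) → (Ring.Carrier R → Ring.Carrier S) → Set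
IsRingHom R S f = RingMorphisms.IsRingHomomorphism (Ring.rawRing R) (Ring.rawRing S) f

IsRingMono : (R S : Ring 0ℓ 0ℓ) → (Ring.Carrier R → Ring.Carrier S) → Set
IsRingMono R S f = RingMorphisms.IsRingMonomorphism (Ring.rawRing R) (Ring.rawRing S) f

module _ (R : CommutativeRing 0ℓ 0ℓ) where
  open CommutativeRing R

  record IsIdeal (I : Pred Carrier 0ℓ) : Set where
    field
      resp  : ∀ {x y} → x ≈ y → I x → I y
      zeroI : I 0#
      plusI : ∀ {x y} → I x → I y → I (x + y)
      multI : ∀ r {x} → I x → I (r * x)

  IsFGIdeal : Pred Carrier 0ℓ → Set
  IsFGIdeal I = Σ ℕ λ n → Σ (Fin n → Carrier) λ g →
    ((i : Fin n) → I (g i)) ×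
    (∀ x → I x → Σ (Fin n → Carrier) λ c → x ≈ ∑ _+_ 0# n (λ i → c i * g i))

  IsNoetherian : Set₁
  IsNoetherian = (I : Pred Carrier 0ℓ) → IsIdeal I → IsFGIdeal I

  IsIntegralDomain : Set
  IsIntegralDomain = (¬ (1# ≈ 0#)) × (∀ x y → x * y ≈ 0# → x ≈ 0# ⊎ y ≈ 0#)

  IsField : Set
  IsField = (¬ (1# ≈ 0#)) × (∀ x → ¬ (x ≈ 0#) → Σ Carrier λ y → x * y ≈ 1#)

IsFieldOfFractions : (R K : CommutativeRing 0ℓ 0ℓ) →
  (CommutativeRing.Carrier R → CommutativeRing.Carrier K) → Set
IsFieldOfFractions R K ι =
  IsField K ×
  IsRingMono (CommutativeRing.ring R) (CommutativeRing.ring K) ι ×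
  (∀ k → Σ (CommutativeRing.Carrier R) λ a → Σ (CommutativeRing.Carrier R) λ b →
     ¬ (CommutativeRing._≈_ K (ι b) (CommutativeRing.0# K)) ×
     CommutativeRing._≈_ K (CommutativeRing._*_ K k (ι b)) (ι a))

-- K ≠ R : the canonical map R → K is not onto
IsProperExtension : (R K : CommutativeRing 0ℓ 0ℓ) →
  (CommutativeRing.Carrier R → CommutativeRing.Carrier K) → Set
IsProperExtension R K ι =
  ¬ (∀ k → Σ (CommutativeRing.Carrier R) λ r → CommutativeRing._≈_ K (ι r) k)

module _ (K : CommutativeRing 0ℓ 0ℓ) (A : Ring 0ℓ 0ℓ)
         (φ : CommutativeRing.Carrier K → Ring.Carrier A) where
  open Ring A

  IsKAlgebra : Set
  IsKAlgebra = IsRingHom (CommutativeRing.ring K) A φ × (∀ k a → φ k * a ≈ a * φ k)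

  linComb : (n : ℕ) → (Fin n → CommutativeRing.Carrier K) → (Fin n → Carrier) → Carrier
  linComb n c e = ∑ _+_ 0# n (λ i → φ (c i) * e i)

  SpansOverK : (n : ℕ) → (Fin n → Carrier) → Set
  SpansOverK n e = ∀ a → Σ (Fin n → CommutativeRing.Carrier K) λ c → a ≈ linComb n c e

  IsKBasis : (n : ℕ) → (Fin n → Carrier) → Set
  IsKBasis n e = SpansOverK n e ×
    (∀ c → linComb n c e ≈ 0# → (i : Fin n) → CommutativeRing._≈_ K (c i) (CommutativeRing.0# K))

  IsFiniteDimensional : Set
  IsFiniteDimensional = Σ ℕ λ n → Σ (Fin n → Carrier) λ e → SpansOverK n e

-- R-orders.  The subring Λ ⊆ A is given as a ring Λ with an injective
-- (unital) ring homomorphism j : Λ → A (its inclusion).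

module _ (R K : CommutativeRing 0ℓ 0ℓ)
         (ι : CommutativeRing.Carrier R → CommutativeRing.Carrier K)
         (A : Ring 0ℓ 0ℓ) (φ : CommutativeRing.Carrier K → Ring.Carrier A)
         (Λ : Ring 0ℓ 0ℓ) (j : Ring.Carrier Λ → Ring.Carrier A) where
  private
    module A = Ring A
    module Λ = Ring Λ
    module R = CommutativeRing R

  _·_ : R.Carrier → A.Carrier → A.Carrier
  r · a = φ (ι r) A.* a

  record IsROrder : Set where
    field
      subring      : IsRingMono Λ A j
      closed-R     : ∀ r x → Σ Λ.Carrier λ y → j y A.≈ (r · j x)
      fin-gen      : Σ ℕ λ n → Σ (Fin n → Λ.Carrier) λ g →
                       ∀ x → Σ (Fin n → R.Carrier) λ c →
                         j x A.≈ ∑ A._+_ A.0# n (λ i → c i · j (g i))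
      contains-basis : Σ ℕ λ n → Σ (Fin n → Λ.Carrier) λ b → IsKBasis K A φ n (λ i → j (b i))

module _ (R : CommutativeRing 0ℓ 0ℓ) (Λ : Ring 0ℓ 0ℓ)
         (ρ : CommutativeRing.Carrier R → Ring.Carrier Λ) where
  private
    module R = CommutativeRing R

  -- X is a Λ-lattice: finitely generated and torsion-free over R,
  -- where r ∈ R acts through ρ r ∈ Λ (ρ r corresponds to r · 1 ∈ Λ).
  IsLattice : LeftModule Λ 0ℓ 0ℓ → Set
  IsLattice X =
    (Σ ℕ λ n → Σ (Fin n → Carrierᴹ) λ g → ∀ m → Σ (Fin n → R.Carrier) λ c →
        m ≈ᴹ ∑ _+ᴹ_ 0ᴹ n (λ i → ρ (c i) *ₗ g i)) ×
    (∀ r m → ¬ (r R.≈ R.0#) → (ρ r *ₗ m) ≈ᴹ 0ᴹ → m ≈ᴹ 0ᴹ)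
    where open LeftModule X

module _ {Λ : Ring 0ℓ 0ℓ} where

  record Hom (X Y : LeftModule Λ 0ℓ 0ℓ) : Set where
    constructor mkHom
    field
      fun    : LeftModule.Carrierᴹ X → LeftModule.Carrierᴹ Y
      isHom  : LeftModuleMorphisms.IsLeftModuleHomomorphism
                 (LeftModule.rawLeftModule X) (LeftModule.rawLeftModule Y) fun
  open Hom public

  End : LeftModule Λ 0ℓ 0ℓ → Set
  End Y = Hom Y Y

  _≈ₕ_ : {X Y : LeftModule Λ 0ℓ 0ℓ} → Hom X Y → Hom X Y → Set
  _≈ₕ_ {X} {Y} f g = ∀ x → LeftModule._≈ᴹ_ Y (fun f x) (fun g x)

  idHom : (X : LeftModule Λ 0ℓ 0ℓ) → Hom X X
  idHom X = mkHom (λ x → x) record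
    { +ᴹ-isGroupHomomorphism = record
      { isMonoidHomomorphism = record
        { isMagmaHomomorphism = record
          { isRelHomomorphism = record { cong = λ p → p }
          ; homo = λ _ _ → refl }
        ; ε-homo = refl }
      ; ⁻¹-homo = λ _ → refl }
    ; *ₗ-homo = λ _ _ → refl }
    where open LeftModule X using () renaming (≈ᴹ-refl to refl)

  zeroHom : (X Y : LeftModule Λ 0ℓ 0ℓ) → Hom X Y
  zeroHom X Y = mkHom (λ _ → Y.0ᴹ) record
    { +ᴹ-isGroupHomomorphism = record
      { isMonoidHomomorphism = record
        { isMagmaHomomorphism = record
          { isRelHomomorphism = record { cong = λ _ → Y.≈ᴹ-refl }
          ; homo = λ _ _ → Y.≈ᴹ-sym (Y.+ᴹ-identityˡ Y.0ᴹ) }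
        ; ε-homo = Y.≈ᴹ-refl }
      ; ⁻¹-homo = λ _ → Y.≈ᴹ-sym -0≈0 }
    ; *ₗ-homo = λ r _ → Y.≈ᴹ-sym (Y.*ₗ-zeroʳ r) }
    where
      module Y = LeftModule Y
      -0≈0 : (Y.-ᴹ Y.0ᴹ) Y.≈ᴹ Y.0ᴹ
      -0≈0 = Y.≈ᴹ-trans (Y.≈ᴹ-sym (Y.+ᴹ-identityʳ (Y.-ᴹ Y.0ᴹ))) (Y.-ᴹ‿inverseˡ Y.0ᴹ)

  _∘ₕ_ : {X Y Z : LeftModule Λ 0ℓ 0ℓ} → Hom Y Z → Hom X Y → Hom X Z
  _∘ₕ_ {X} {Y} {Z} g f = mkHom (λ x → fun g (fun f x)) record
    { +ᴹ-isGroupHomomorphism = record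
      { isMonoidHomomorphism = record
        { isMagmaHomomorphism = record
          { isRelHomomorphism = record { cong = λ p → G.⟦⟧-cong (F.⟦⟧-cong p) }
          ; homo = λ x y → Z.≈ᴹ-trans (G.⟦⟧-cong (F.+ᴹ-homo x y)) (G.+ᴹ-homo _ _) }
        ; ε-homo = Z.≈ᴹ-trans (G.⟦⟧-cong F.0ᴹ-homo) G.0ᴹ-homo }
      ; ⁻¹-homo = λ x → Z.≈ᴹ-trans (G.⟦⟧-cong (F.-ᴹ-homo x)) (G.-ᴹ-homo _) }
    ; *ₗ-homo = λ r x → Z.≈ᴹ-trans (G.⟦⟧-cong (F.*ₗ-homo r x)) (G.*ₗ-homo r _) }
    where
      module Z = LeftModule Z
      module F = LeftModuleMorphisms.IsLeftModuleHomomorphism (isHom f)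
      module G = LeftModuleMorphisms.IsLeftModuleHomomorphism (isHom g)

  IsIsomorphism : {X Y : LeftModule Λ 0ℓ 0ℓ} → Hom X Y → Set
  IsIsomorphism {X} {Y} f = Σ (Hom Y X) λ g → ((g ∘ₕ f) ≈ₕ idHom X) × ((f ∘ₕ g) ≈ₕ idHom Y)

  _≅_ : LeftModule Λ 0ℓ 0ℓ → LeftModule Λ 0ℓ 0ℓ → Set
  X ≅ Y = Σ (Hom X Y) IsIsomorphism

  -- Hom_Λ(X,Y) is a left End_Λ(Y)-module via e · h = e ∘ h.
  -- g is a free generator: {g} is an End_Λ(Y)-basis of Hom_Λ(X,Y).
  IsFreeGenerator : {X Y : LeftModule Λ 0ℓ 0ℓ} → Hom X Y → Set
  IsFreeGenerator {X} {Y} g =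
    (∀ (h : Hom X Y) → Σ (End Y) λ e → h ≈ₕ (e ∘ₕ g)) ×
    (∀ (e : End Y) → (e ∘ₕ g) ≈ₕ zeroHom X Y → e ≈ₕ zeroHom Y Y)

  IsFreeOfRank1 : (X Y : LeftModule Λ 0ℓ 0ℓ) → Set
  IsFreeOfRank1 X Y = Σ (Hom X Y) IsFreeGenerator

{-# OPTIONS --safe #-}
-- If f : X ≅ Y then every h : X → Y factors
-- as (h ∘ f⁻¹) ∘ f, so f is a free generator. Conversely, if g is a free generator
-- and f an isomorphism, write f = e ∘ g and g = e' ∘ f; then e' ∘ e fixes g, so
-- e' ∘ e = id by freeness, and f⁻¹ ∘ e is a two-sided inverse of g.
module Submission where

open import Defs
open import Level using (0ℓ)
open import Data.Product using (Σ; _×_; _,_; proj₁)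
open import Function using (_⇔_; mk⇔)
open import Algebra.Bundles using (Ring; CommutativeRing; AbelianGroup)
open import Algebra.Module.Bundles using (LeftModule)
open import Algebra.Module.Morphism.Structures using (module LeftModuleMorphisms)
import Algebra.Properties.AbelianGroup as AbelianGroupProperties
import Algebra.Properties.CommutativeSemigroup as CommutativeSemigroupProperties
import Relation.Binary.Reasoning.Setoid as SetoidReasoning

module _ {Λ : Ring 0ℓ 0ℓ} where

  ⟦_⟧-cong : {X Y : LeftModule Λ 0ℓ 0ℓ} (f : Hom X Y) → ∀ {x x′} →
             LeftModule._≈ᴹ_ X x x′ → LeftModule._≈ᴹ_ Y (fun f x) (fun f x′)
  ⟦ f ⟧-cong = LeftModuleMorphisms.IsLeftModuleHomomorphism.⟦⟧-cong (isHom f)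

  module _ (Y : LeftModule Λ 0ℓ 0ℓ) where
    open LeftModule Y
    private
      module P = AbelianGroupProperties +ᴹ-abelianGroup
    open SetoidReasoning ≈ᴹ-setoid

    *ₗ-neg : ∀ r y → (r *ₗ (-ᴹ y)) ≈ᴹ (-ᴹ (r *ₗ y))
    *ₗ-neg r y = P.inverseʳ-unique (r *ₗ y) (r *ₗ (-ᴹ y)) (begin
      (r *ₗ y) +ᴹ (r *ₗ (-ᴹ y)) ≈⟨ ≈ᴹ-sym (*ₗ-distribˡ r y (-ᴹ y)) ⟩
      r *ₗ (y +ᴹ (-ᴹ y))        ≈⟨ *ₗ-congˡ (-ᴹ‿inverseʳ y) ⟩
      r *ₗ 0ᴹ                   ≈⟨ *ₗ-zeroʳ r ⟩
      0ᴹ                        ∎)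

  _-ₕ_ : {X Y : LeftModule Λ 0ℓ 0ℓ} → Hom X Y → Hom X Y → Hom X Y
  _-ₕ_ {X} {Y} f g = mkHom (λ x → fun f x +ᴹ (-ᴹ fun g x)) record
    { +ᴹ-isGroupHomomorphism = record
      { isMonoidHomomorphism = record
        { isMagmaHomomorphism = record
          { isRelHomomorphism = record
            { cong = λ p → +ᴹ-cong (⟦ f ⟧-cong p) (-ᴹ‿cong (⟦ g ⟧-cong p)) }
          ; homo = λ x y → begin
              fun f (x X.+ᴹ y) +ᴹ (-ᴹ fun g (x X.+ᴹ y))
                ≈⟨ +ᴹ-cong (F.+ᴹ-homo x y) (-ᴹ‿cong (G.+ᴹ-homo x y)) ⟩
              (fun f x +ᴹ fun f y) +ᴹ (-ᴹ (fun g x +ᴹ fun g y))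
                ≈⟨ +ᴹ-congˡ (≈ᴹ-sym (P.⁻¹-∙-comm _ _)) ⟩
              (fun f x +ᴹ fun f y) +ᴹ ((-ᴹ fun g x) +ᴹ (-ᴹ fun g y))
                ≈⟨ C.interchange _ _ _ _ ⟩
              (fun f x +ᴹ (-ᴹ fun g x)) +ᴹ (fun f y +ᴹ (-ᴹ fun g y)) ∎ }
        ; ε-homo = begin
            fun f X.0ᴹ +ᴹ (-ᴹ fun g X.0ᴹ) ≈⟨ +ᴹ-cong F.0ᴹ-homo (-ᴹ‿cong G.0ᴹ-homo) ⟩
            0ᴹ +ᴹ (-ᴹ 0ᴹ)                ≈⟨ -ᴹ‿inverseʳ 0ᴹ ⟩
            0ᴹ                           ∎ }
      ; ⁻¹-homo = λ x → begin
          fun f (X.-ᴹ x) +ᴹ (-ᴹ fun g (X.-ᴹ x))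
            ≈⟨ +ᴹ-cong (F.-ᴹ-homo x) (-ᴹ‿cong (G.-ᴹ-homo x)) ⟩
          (-ᴹ fun f x) +ᴹ (-ᴹ (-ᴹ fun g x)) ≈⟨ P.⁻¹-∙-comm _ _ ⟩
          -ᴹ (fun f x +ᴹ (-ᴹ fun g x))      ∎ }
    ; *ₗ-homo = λ r x → begin
        fun f (r X.*ₗ x) +ᴹ (-ᴹ fun g (r X.*ₗ x))
          ≈⟨ +ᴹ-cong (F.*ₗ-homo r x) (-ᴹ‿cong (G.*ₗ-homo r x)) ⟩
        (r *ₗ fun f x) +ᴹ (-ᴹ (r *ₗ fun g x)) ≈⟨ +ᴹ-congˡ (≈ᴹ-sym (*ₗ-neg Y r _)) ⟩
        (r *ₗ fun f x) +ᴹ (r *ₗ (-ᴹ fun g x)) ≈⟨ ≈ᴹ-sym (*ₗ-distribˡ r _ _) ⟩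
        r *ₗ (fun f x +ᴹ (-ᴹ fun g x))        ∎ }
    where
      module X = LeftModule X
      open LeftModule Y
      module P = AbelianGroupProperties +ᴹ-abelianGroup
      module C = CommutativeSemigroupProperties (AbelianGroup.commutativeSemigroup +ᴹ-abelianGroup)
      module F = LeftModuleMorphisms.IsLeftModuleHomomorphism (isHom f)
      module G = LeftModuleMorphisms.IsLeftModuleHomomorphism (isHom g)
      open SetoidReasoning ≈ᴹ-setoid

  module _ {X Y : LeftModule Λ 0ℓ 0ℓ} where
    private
      module X = LeftModule X
      module Y = LeftModule Y
      module P = AbelianGroupProperties Y.+ᴹ-abelianGroup

    freeGenerator-cancelʳ : (g : Hom X Y) → IsFreeGenerator g → (e e′ : End Y) →
                            (e ∘ₕ g) ≈ₕ (e′ ∘ₕ g) → e ≈ₕ e′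
    freeGenerator-cancelʳ _ (_ , faithful) e e′ eg≈e′g y =
      P.x∙y⁻¹≈ε⇒x≈y _ _ (faithful (e -ₕ e′)
        (λ x → Y.≈ᴹ-trans (Y.+ᴹ-congʳ (eg≈e′g x)) (Y.-ᴹ‿inverseʳ _)) y)

    isomorphism⇒freeGenerator : (f : Hom X Y) → IsIsomorphism f → IsFreeGenerator f
    isomorphism⇒freeGenerator f (f⁻¹ , f⁻¹f≈id , ff⁻¹≈id) = factor , faithful
      where
      factor : ∀ h → Σ (End Y) λ e → h ≈ₕ (e ∘ₕ f)
      factor h = h ∘ₕ f⁻¹ , λ x → ⟦ h ⟧-cong (X.≈ᴹ-sym (f⁻¹f≈id x))
      faithful : ∀ e → (e ∘ₕ f) ≈ₕ zeroHom X Y → e ≈ₕ zeroHom Y Y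
      faithful e ef≈0 y = Y.≈ᴹ-trans (⟦ e ⟧-cong (Y.≈ᴹ-sym (ff⁻¹≈id y))) (ef≈0 (fun f⁻¹ y))

    freeGenerator⇒isomorphism : X ≅ Y → (g : Hom X Y) → IsFreeGenerator g → IsIsomorphism g
    freeGenerator⇒isomorphism (f , f-iso@(f⁻¹ , f⁻¹f≈id , ff⁻¹≈id)) g g-free@(factor , _) =
      f⁻¹ ∘ₕ e , inverseˡ , inverseʳ
      where
      open Σ (factor f) renaming (proj₁ to e; proj₂ to f≈eg)
      open Σ (proj₁ (isomorphism⇒freeGenerator f f-iso) g) renaming (proj₁ to e′; proj₂ to g≈e′f)
      e′e≈id : (e′ ∘ₕ e) ≈ₕ idHom Y
      e′e≈id = freeGenerator-cancelʳ g g-free (e′ ∘ₕ e) (idHom Y)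
        (λ x → Y.≈ᴹ-trans (⟦ e′ ⟧-cong (Y.≈ᴹ-sym (f≈eg x))) (Y.≈ᴹ-sym (g≈e′f x)))
      inverseˡ : ((f⁻¹ ∘ₕ e) ∘ₕ g) ≈ₕ idHom X
      inverseˡ x = X.≈ᴹ-trans (⟦ f⁻¹ ⟧-cong (Y.≈ᴹ-sym (f≈eg x))) (f⁻¹f≈id x)
      inverseʳ : (g ∘ₕ (f⁻¹ ∘ₕ e)) ≈ₕ idHom Y
      inverseʳ y = Y.≈ᴹ-trans (g≈e′f _) (Y.≈ᴹ-trans (⟦ e′ ⟧-cong (ff⁻¹≈id _)) (e′e≈id y))

proposition3p1 :
    (R : CommutativeRing 0ℓ 0ℓ) → IsNoetherian R → IsIntegralDomain R →
    (K : CommutativeRing 0ℓ 0ℓ) (ι : CommutativeRing.Carrier R → CommutativeRing.Carrier K) →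
    IsFieldOfFractions R K ι → IsProperExtension R K ι →
    (A : Ring 0ℓ 0ℓ) (φ : CommutativeRing.Carrier K → Ring.Carrier A) →
    IsKAlgebra K A φ → IsFiniteDimensional K A φ →
    (Λ : Ring 0ℓ 0ℓ) (j : Ring.Carrier Λ → Ring.Carrier A) →
    IsROrder R K ι A φ Λ j →
    (ρ : CommutativeRing.Carrier R → Ring.Carrier Λ) →
    (∀ r → Ring._≈_ A (j (ρ r)) (φ (ι r))) →
    (X Y : LeftModule Λ 0ℓ 0ℓ) → IsLattice R Λ ρ X → IsLattice R Λ ρ Y →
    (X ≅ Y) ⇔ (IsFreeOfRank1 X Y × (∀ (g : Hom X Y) → IsFreeGenerator g → IsIsomorphism g))
proposition3p1 _ _ _ _ _ _ _ _ _ _ _ _ _ _ _ _ X Y _ _ = mk⇔ to from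
  where
  to : X ≅ Y → IsFreeOfRank1 X Y × (∀ (g : Hom X Y) → IsFreeGenerator g → IsIsomorphism g)
  to X≅Y@(f , f-iso) =
    (f , isomorphism⇒freeGenerator f f-iso) , freeGenerator⇒isomorphism X≅Y
  from : IsFreeOfRank1 X Y × (∀ (g : Hom X Y) → IsFreeGenerator g → IsIsomorphism g) → X ≅ Y
  from ((g , g-free) , free⇒iso) = g , free⇒iso g g-free
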